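{- Let $\mathcal{A}$ be a complementary alphabet and let $P=p_1\cdots p_{2n}$ be a word in $\mathcal{A}$ that has at least one $P$-valid plane tree. Then the $P$-valid plane tree $T_0(P)$ produced by the greedy algorithm admits no valid local move of type 2.
   Context: A complementary alphabet $\mathcal{A}$ is a finite set in which every letter $B$ has a unique complement $\overline{B}\in\mathcal{A}$, with $\overline{B}\neq B$ and $\overline{\overline{B}}=B$. A plane tree is a rooted tree in which the children of each vertex are linearly ordered. For a plane tree with $n$ edges, label the $2n$ half-edges $1,\dots,2n$ by starting on the left side of the leftmost edge at the root and walking around the tree counterclockwise; each edge is written $e(i,j)$, $i<j$, with $i,j$ the labels of its two sides (the edge set is a noncrossing perfect matching of $\{1,\dots,2n\}$). A plane tree with $n$ edges is $P$-valid if $p_i,p_j$ are complements for every edge $e(i,j)$. Local moves on a plane tree $S$, for $i<j<i'<j'$: type 1: if $e(i,j)$ and $e(i',j')$ are edges of $S$ sharing a vertex, replace them by $e(i,j')$ and $e(j,i')$; type 2: if $e(i,j')$ and $e(j,i')$ are edges of $S$ sharing a vertex, replace them by $e(i,j)$ and $e(i',j')$. Each yields a plane tree $S'$. A local move on a $P$-valid tree $S$ is valid if the resulting $S'$ is also $P$-valid. The greedy algorithm on $P$: process positions $i=1,\dots,2n$ in order; at position $i$ let $j_i<i$ be the largest currently unmatched position; if $p_i,p_{j_i}$ are complements, match them (edge $e(j_i,i)$), otherwise leave $i$ unmatched. When a $P$-valid tree exists, the output of this algorithm is a $P$-valid plane tree, denoted $T_0(P)$. -}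

module Defs where

open import Data.Nat using (ℕ; zero; suc; _+_; _*_; _∸_; _≤_; _<_)
open import Data.Fin using (Fin; _≟_)
open import Data.Vec using (Vec; []; _∷_)
open import Data.List using (List; []; _∷_; reverse)
open import Data.List.Membership.Propositional using (_∈_)
open import Data.Maybe using (Maybe; just; nothing)
open import Data.Product using (_×_; _,_; ∃; ∃-syntax; Σ-syntax)
open import Data.Sum using (_⊎_)
open import Relation.Nullary using (¬_; yes; no)
open import Relation.Binary.PropositionalEquality using (_≡_)

record ComplementaryAlphabet : Set where
  field
    size      : ℕ
    comp      : Fin size → Fin size
    comp-inv  : ∀ b → comp (comp b) ≡ b
    comp-diff : ∀ b → ¬ (comp b ≡ b)

open ComplementaryAlphabet public

module _ (𝒜 : ComplementaryAlphabet) where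

  Letter : Set
  Letter = Fin (size 𝒜)

  Word : ℕ → Set
  Word n = Vec Letter (2 * n)

  -- 1-based lookup: letterAt P t = just p_t for 1 ≤ t ≤ length, nothing otherwise.
  letterAt : ∀ {m} → Vec Letter m → ℕ → Maybe Letter
  letterAt []       _             = nothing
  letterAt (x ∷ xs) zero          = nothing
  letterAt (x ∷ xs) (suc zero)    = just x
  letterAt (x ∷ xs) (suc (suc t)) = letterAt xs (suc t)

  Compl : (n : ℕ) → Word n → ℕ → ℕ → Set
  Compl n P i j = ∃[ a ] ∃[ b ] (letterAt P i ≡ just a × letterAt P j ≡ just b × b ≡ comp 𝒜 a)

  -- A plane tree with n edges, represented (via the half-edge labelling of
  -- the context) by its edge set: a list of pairs (i , j) meaning e(i,j).
  Tree : Set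
  Tree = List (ℕ × ℕ)

  Edge : Tree → ℕ → ℕ → Set
  Edge T i j = (i , j) ∈ T

  IsPlaneTree : ℕ → Tree → Set
  IsPlaneTree n T =
      (∀ i j → Edge T i j → 1 ≤ i × i < j × j ≤ 2 * n)
    × (∀ t → 1 ≤ t → t ≤ 2 * n → ∃[ u ] (Edge T t u ⊎ Edge T u t))
    × (∀ i j k l → Edge T i j → Edge T k l →
         (i ≡ k ⊎ i ≡ l ⊎ j ≡ k ⊎ j ≡ l) → (i ≡ k × j ≡ l))
    × (∀ a b c d → Edge T a b → Edge T c d → ¬ (a < c × c < b × b < d))

  PValid : (n : ℕ) → Word n → Tree → Set
  PValid n P T = IsPlaneTree n T × (∀ i j → Edge T i j → Compl n P i j)

  -- Corners 0,…,2n of the contour walk: corner t is the vertex reached after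
  -- traversing half-edge t (corner 0 = root). For s ≤ t, corners s and t are
  -- the same vertex iff the half-edges s+1,…,t form complete subtrees, i.e.
  -- no edge has exactly one side in (s , t].
  ClosedInterval : Tree → ℕ → ℕ → Set
  ClosedInterval T s t = ∀ a b → Edge T a b →
    ((s < a × a ≤ t) → (s < b × b ≤ t)) × ((s < b × b ≤ t) → (s < a × a ≤ t))

  SameVertex : Tree → ℕ → ℕ → Set
  SameVertex T c c' = (c ≤ c' → ClosedInterval T c c') × (c' ≤ c → ClosedInterval T c' c)

  -- Edge e(i,j) joins the vertices at corners i-1 (upper endpoint) and i (lower endpoint).
  ShareVertex : Tree → ℕ → ℕ → Set
  ShareVertex T i k =
    ∃[ c ] ∃[ c' ] ((c ≡ i ∸ 1 ⊎ c ≡ i) × (c' ≡ k ∸ 1 ⊎ c' ≡ k) × SameVertex T c c')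

  Type2Move : Tree → Tree → ℕ → ℕ → ℕ → ℕ → Set
  Type2Move S S' i j i' j' =
      i < j × j < i' × i' < j'
    × Edge S i j' × Edge S j i' × ShareVertex S i j
    × (∀ a b → Edge S' a b →
         ((Edge S a b × ¬ ((a , b) ≡ (i , j')) × ¬ ((a , b) ≡ (j , i')))
          ⊎ (a , b) ≡ (i , j) ⊎ (a , b) ≡ (i' , j')))
    × (∀ a b → Edge S a b → ¬ ((a , b) ≡ (i , j')) → ¬ ((a , b) ≡ (j , i')) → Edge S' a b)
    × Edge S' i j × Edge S' i' j'

  ValidType2Move : (n : ℕ) → Word n → Tree → Set
  ValidType2Move n P S =
    ∃[ S' ] Σ[ i ∈ ℕ ] Σ[ j ∈ ℕ ] Σ[ i' ∈ ℕ ] Σ[ j' ∈ ℕ ]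
      (Type2Move S S' i j i' j' × PValid n P S')

  -- Greedy algorithm. The stack holds the currently unmatched positions
  -- (with their letters), most recent (= largest) on top.
  greedyStep : List (ℕ × Letter) → Tree → ℕ → Letter → List (ℕ × Letter) × Tree
  greedyStep [] E i a = ((i , a) ∷ []) , E
  greedyStep ((j , b) ∷ st) E i a with a ≟ comp 𝒜 b
  ... | yes _ = st , ((j , i) ∷ E)
  ... | no  _ = ((i , a) ∷ (j , b) ∷ st) , E

  greedyGo : ∀ {m} → ℕ → Vec Letter m → List (ℕ × Letter) → Tree → Tree
  greedyGo i []       st E = E
  greedyGo i (a ∷ as) st E with greedyStep st E i a
  ... | st' , E' = greedyGo (suc i) as st' E'

  T₀ : (n : ℕ) → Word n → Tree
  T₀ n P = reverse (greedyGo 1 P [] [])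

-- Greedy matching is a stack discipline: an unmatched position stays on the
-- stack until its partner arrives, and no position can be popped while a
-- later one sits above it.  Suppose T₀(P) had edges e(i,j') and e(j,i'),
-- i < j < i' < j', sharing a vertex.  Then no edge leaves the open interval
-- (i,j) to the right, so every position pushed after i has been popped before
-- time j: at time j the position i is on top of the stack.  If p_i and p_j
-- were complements, the greedy algorithm would match i with j, not with j'.
module Submission where

open import Defs
open import Data.Nat using (ℕ; suc; _+_; _∸_; _≤_; _<_; z≤n; s≤s)
open import Data.Nat.Properties
  using (+-identityʳ; +-suc; ≤-refl; ≤-trans; <⇒≤; <⇒≱; <-irrefl; <-asym; <-trans; ≤-<-trans; m≤n⇒m≤1+n; m≤n⇒m<n∨m≡n; n<1+n; m∸n≤m)
open import Data.Fin using (_≟_)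
open import Data.Vec using (Vec; []; _∷_)
open import Data.List using (List; []; _∷_)
open import Data.List.Relation.Unary.Any using (here; there)
open import Data.List.Relation.Unary.All as All using (All; []; _∷_)
open import Data.List.Relation.Unary.AllPairs using (AllPairs; []; _∷_)
import Data.List.Relation.Unary.Any.Properties as Any
open import Data.List.Membership.Propositional using (_∈_; _∉_)
open import Data.Maybe using (just)
open import Data.Product using (_×_; _,_; ∃-syntax; proj₁; proj₂)
open import Data.Sum using (_⊎_; inj₁; inj₂)
open import Data.Empty using (⊥-elim)
open import Relation.Nullary using (¬_; yes; no)
open import Relation.Binary.PropositionalEquality using (_≡_; _≢_; refl; sym; trans; cong)

module _ (𝒜 : ComplementaryAlphabet) where

  Enclosed : Tree 𝒜 → ℕ → ℕ → Set
  Enclosed T i j = ∀ k l → Edge 𝒜 T k l → i < k → k < j → l < j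

  corner≤ : ∀ {c i} → c ≡ i ∸ 1 ⊎ c ≡ i → c ≤ i
  corner≤ {i = i} (inj₁ refl) = m∸n≤m i 1
  corner≤ (inj₂ refl)         = ≤-refl

  upper-end-inside : ∀ {T c c' a b} → ClosedInterval 𝒜 T c c' → Edge 𝒜 T a b → c < a → a ≤ c' → b ≤ c'
  upper-end-inside closed ab c<a a≤c' = proj₂ (proj₁ (closed _ _ ab) (c<a , a≤c'))

  -- The corner shared with i cannot be the lower end of half-edge j, since
  -- e(j,i') would then leave the closed interval; so it is corner j - 1.
  shareVertex⇒enclosed : ∀ (T : Tree 𝒜) {i j i'} → i < j → j < i' → Edge 𝒜 T j i' →
                         ShareVertex 𝒜 T i j → Enclosed T i j
  shareVertex⇒enclosed T i<j j<i' ji' (_ , _ , c-corner , inj₂ refl , same) k l kl i<k k<j =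
    ⊥-elim (<⇒≱ j<i' (upper-end-inside (proj₁ same (≤-trans (corner≤ c-corner) (<⇒≤ i<j))) ji'
                                        (≤-<-trans (corner≤ c-corner) i<j) ≤-refl))
  shareVertex⇒enclosed T (s≤s i≤j-1) j<i' ji' (_ , _ , c-corner , inj₁ refl , same) k l kl i<k (s≤s k≤j-1) =
    s≤s (upper-end-inside (proj₁ same (≤-trans (corner≤ c-corner) i≤j-1)) kl (≤-<-trans (corner≤ c-corner) i<k) k≤j-1)

module Greedy (𝒜 : ComplementaryAlphabet) where

  Stack : Set
  Stack = List (ℕ × Letter 𝒜)

  OnStack : ℕ → Stack → Set
  OnStack a st = ∃[ c ] (a , c) ∈ st

  step : Stack → Tree 𝒜 → ℕ → Letter 𝒜 → Stack × Tree 𝒜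
  step = greedyStep 𝒜

  run : ∀ {m} → ℕ → Vec (Letter 𝒜) m → Stack → Tree 𝒜 → Tree 𝒜
  run = greedyGo 𝒜

  record Invariant (t : ℕ) (st : Stack) (E : Tree 𝒜) : Set where
    field
      decreasing  : AllPairs (λ p q → proj₁ q < proj₁ p) st
      stack-below : All (λ p → proj₁ p < t) st
      edges-below : All (λ e → proj₂ e < t) E

  open Invariant

  below-suc : ∀ {A : Set} {f : A → ℕ} {t xs} → All (λ x → f x < t) xs → All (λ x → f x < suc t) xs
  below-suc = All.map m≤n⇒m≤1+n

  step-invariant : ∀ {t st E} x → Invariant t st E →
                   Invariant (suc t) (proj₁ (step st E t x)) (proj₂ (step st E t x))
  step-invariant {st = []} x inv = record
    { decreasing = [] ∷ [] ; stack-below = n<1+n _ ∷ [] ; edges-below = below-suc (edges-below inv) }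
  step-invariant {st = (j , b) ∷ st} x inv with x ≟ comp 𝒜 b | decreasing inv | stack-below inv
  ... | yes _ | _ ∷ dec | _ ∷ below = record
    { decreasing = dec ; stack-below = below-suc below ; edges-below = n<1+n _ ∷ below-suc (edges-below inv) }
  ... | no _ | dec | below = record
    { decreasing = below ∷ dec ; stack-below = n<1+n _ ∷ below-suc below ; edges-below = below-suc (edges-below inv) }

  step-⊇ : ∀ {e} st E t x → e ∈ E → e ∈ proj₂ (step st E t x)
  step-⊇ [] E t x e∈E = e∈E
  step-⊇ ((j , b) ∷ st) E t x e∈E with x ≟ comp 𝒜 b
  ... | yes _ = there e∈E
  ... | no _  = e∈E

  step-edge : ∀ {a b} st E t x → (a , b) ∈ proj₂ (step st E t x) → (a , b) ∈ E ⊎ (b ≡ t × OnStack a st)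
  step-edge [] E t x ab = inj₁ ab
  step-edge ((j , c) ∷ st) E t x ab with x ≟ comp 𝒜 c | ab
  ... | yes _ | here refl = inj₂ (refl , c , here refl)
  ... | yes _ | there ab' = inj₁ ab'
  ... | no _  | ab'       = inj₁ ab'

  step-onStack : ∀ {a} st E t x → OnStack a (proj₁ (step st E t x)) → OnStack a st ⊎ a ≡ t
  step-onStack [] E t x (_ , here refl) = inj₂ refl
  step-onStack ((j , c) ∷ st) E t x (d , a∈) with x ≟ comp 𝒜 c | a∈
  ... | yes _ | a∈'        = inj₁ (d , there a∈')
  ... | no _  | here refl  = inj₂ refl
  ... | no _  | there a∈'  = inj₁ (d , a∈')

  run-⊇ : ∀ {m e} t (xs : Vec (Letter 𝒜) m) st E → e ∈ E → e ∈ run t xs st E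
  run-⊇ t []       st E e∈E = e∈E
  run-⊇ t (x ∷ xs) st E e∈E = run-⊇ (suc t) xs _ _ (step-⊇ st E t x e∈E)

  run-edge : ∀ {m a b} t (xs : Vec (Letter 𝒜) m) st E → (a , b) ∈ run t xs st E →
             (a , b) ∈ E ⊎ (t ≤ b × (OnStack a st ⊎ t ≤ a))
  run-edge t [] st E ab = inj₁ ab
  run-edge t (x ∷ xs) st E ab with run-edge (suc t) xs _ _ ab
  ... | inj₂ (t<b , inj₂ t<a) = inj₂ (<⇒≤ t<b , inj₂ (<⇒≤ t<a))
  ... | inj₂ (t<b , inj₁ a∈) with step-onStack st E t x a∈
  ...   | inj₁ a∈st = inj₂ (<⇒≤ t<b , inj₁ a∈st)
  ...   | inj₂ refl = inj₂ (<⇒≤ t<b , inj₂ ≤-refl)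
  run-edge t (x ∷ xs) st E ab | inj₁ ab' with step-edge st E t x ab'
  ... | inj₁ ab″ = inj₁ ab″
  ... | inj₂ (refl , a∈st) = inj₂ (≤-refl , inj₁ a∈st)

  run-new-edge-late : ∀ {m a b t st E} (xs : Vec (Letter 𝒜) m) → Invariant t st E →
                      (a , b) ∈ run t xs st E → (a , b) ∉ E → t ≤ b
  run-new-edge-late {t = t} {st} {E} xs inv ab ab∉E with run-edge t xs st E ab
  ... | inj₁ ab∈E      = ⊥-elim (ab∉E ab∈E)
  ... | inj₂ (t≤b , _) = t≤b

  edges-below⇒∉ : ∀ {t a b} {E : Tree 𝒜} → All (λ e → proj₂ e < t) E → t ≤ b → (a , b) ∉ E
  edges-below⇒∉ below t≤b ab = <⇒≱ (All.lookup below ab) t≤b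

  -- k sits above a, so it is popped before a is.
  run-lifo : ∀ {m t st E a k b} (xs : Vec (Letter 𝒜) m) → Invariant t st E →
             OnStack a st → OnStack k st → a < k →
             (a , b) ∈ run t xs st E → (a , b) ∉ E →
             ∃[ l ] ((k , l) ∈ run t xs st E × (k , l) ∉ E)
  run-lifo [] inv a∈ k∈ a<k ab ab∉E = ⊥-elim (ab∉E ab)
  run-lifo {st = []} (x ∷ xs) inv (_ , ()) k∈ a<k ab ab∉E
  run-lifo {t = t} {(j , c) ∷ st} (x ∷ xs) inv (d , a∈) (e , k∈) a<k ab ab∉E
    with x ≟ comp 𝒜 c | decreasing inv | step-invariant x inv
  ... | no _  | _ | inv' = run-lifo xs inv' (d , there a∈) (e , there k∈) a<k ab ab∉E
  ... | yes _ | below-j ∷ _ | inv' with k∈ | a∈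
  ...   | here refl | _ = t , run-⊇ (suc t) xs st _ (here refl) , edges-below⇒∉ (edges-below inv) ≤-refl
  ...   | there k∈' | here refl = ⊥-elim (<-asym a<k (All.lookup below-j k∈'))
  ...   | there k∈' | there a∈'
    with run-lifo xs inv' (d , a∈') (e , k∈') a<k ab
           (λ { (here refl) → <-asym a<k (All.lookup below-j k∈') ; (there ab∈E) → ab∉E ab∈E })
  ...     | l , kl , kl∉E' = l , kl , λ kl∈E → kl∉E' (there kl∈E)

  run-top-survives : ∀ {m t k c st E b} x (xs : Vec (Letter 𝒜) m) → Invariant t ((k , c) ∷ st) E →
                     (k , b) ∈ run t (x ∷ xs) ((k , c) ∷ st) E → t < b → x ≢ comp 𝒜 c
  run-top-survives {t = t} {k} {c} {st} {E} x xs inv kb t<b with x ≟ comp 𝒜 c | decreasing inv | kb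
  ... | no x≢c | _ | _ = x≢c
  ... | yes _ | below-k ∷ _ | kb' with run-edge (suc t) xs st ((k , t) ∷ E) kb'
  ...   | inj₁ (here refl)         = λ _ → <-irrefl refl t<b
  ...   | inj₁ (there kb∈E)        = λ _ → edges-below⇒∉ (edges-below inv) (<⇒≤ t<b) kb∈E
  ...   | inj₂ (_ , inj₁ (_ , k∈)) = λ _ → <-irrefl refl (All.lookup below-k k∈)
  ...   | inj₂ (_ , inj₂ t<k)      = λ _ → <⇒≱ (All.head (stack-below inv)) (<⇒≤ t<k)

  module _ (n : ℕ) (P : Word 𝒜 n) where

    Faithful : Stack → Set
    Faithful st = All (λ p → letterAt 𝒜 P (proj₁ p) ≡ just (proj₂ p)) st

    Suffix : ∀ {m} → ℕ → Vec (Letter 𝒜) m → Set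
    Suffix t xs = ∀ d → letterAt 𝒜 P (t + d) ≡ letterAt 𝒜 xs (suc d)

    suffix-head : ∀ {m t x} {xs : Vec (Letter 𝒜) m} → Suffix t (x ∷ xs) → letterAt 𝒜 P t ≡ just x
    suffix-head {t = t} suffix = trans (cong (letterAt 𝒜 P) (sym (+-identityʳ t))) (suffix 0)

    suffix-tail : ∀ {m t x} {xs : Vec (Letter 𝒜) m} → Suffix t (x ∷ xs) → Suffix (suc t) xs
    suffix-tail {t = t} suffix d = trans (cong (letterAt 𝒜 P) (sym (+-suc t d))) (suffix (suc d))

    step-faithful : ∀ {st t x} E → Faithful st → letterAt 𝒜 P t ≡ just x → Faithful (proj₁ (step st E t x))
    step-faithful {[]} E faithful px = px ∷ []
    step-faithful {(j , c) ∷ st} {x = x} E faithful px with x ≟ comp 𝒜 c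
    ... | yes _ = All.tail faithful
    ... | no _  = px ∷ faithful

    compl⇒comp : ∀ {i j c x} → letterAt 𝒜 P i ≡ just c → letterAt 𝒜 P j ≡ just x →
                 Compl 𝒜 n P i j → x ≡ comp 𝒜 c
    compl⇒comp pc px (a , b , pa , pb , b≡a̅) with trans (sym pc) pa | trans (sym px) pb
    ... | refl | refl = b≡a̅

    run-skips-no-complement-now : ∀ {m j st E i j'} x (xs : Vec (Letter 𝒜) m) → Invariant j st E → Faithful st →
                      letterAt 𝒜 P j ≡ just x → i < j → j < j' → (i , j') ∈ run j (x ∷ xs) st E →
                      Enclosed 𝒜 (run j (x ∷ xs) st E) i j → ¬ Compl 𝒜 n P i j
    run-skips-no-complement-now {j = j} {st} {E} x xs inv faithful px i<j j<j' ij' enclosed compl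
      with run-edge j (x ∷ xs) st E ij'
    ... | inj₁ ij'∈E             = edges-below⇒∉ (edges-below inv) (<⇒≤ j<j') ij'∈E
    ... | inj₂ (_ , inj₂ j≤i)    = <⇒≱ i<j j≤i
    ... | inj₂ (_ , inj₁ (d , i∈)) with st | i∈ | decreasing inv | stack-below inv | faithful | inv
    ...   | (k , c) ∷ st' | here refl  | _ | _ | pc ∷ _ | inv' =
      run-top-survives x xs inv' ij' j<j' (compl⇒comp pc px compl)
    ...   | (k , c) ∷ st' | there i∈' | below-k ∷ _ | k<j ∷ _ | _ | inv'
      with run-lifo (x ∷ xs) inv' (d , there i∈') (c , here refl) (All.lookup below-k i∈') ij'
             (edges-below⇒∉ (edges-below inv') (<⇒≤ j<j'))
    ...     | l , kl , kl∉E = <⇒≱ (enclosed k l kl (All.lookup below-k i∈') k<j) (run-new-edge-late (x ∷ xs) inv' kl kl∉E)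

    run-skips-no-complement : ∀ {m t st E i j j'} (xs : Vec (Letter 𝒜) m) → Invariant t st E → Faithful st →
                              Suffix t xs → t ≤ j → i < j → j < j' → (i , j') ∈ run t xs st E →
                              Enclosed 𝒜 (run t xs st E) i j → ¬ Compl 𝒜 n P i j
    run-skips-no-complement [] inv faithful suffix t≤j i<j j<j' ij' enclosed compl =
      edges-below⇒∉ (edges-below inv) (≤-trans t≤j (<⇒≤ j<j')) ij'
    run-skips-no-complement {E = E} (x ∷ xs) inv faithful suffix t≤j i<j j<j' ij' enclosed
      with m≤n⇒m<n∨m≡n t≤j
    ... | inj₁ t<j = run-skips-no-complement xs (step-invariant x inv)
                       (step-faithful E faithful (suffix-head suffix)) (suffix-tail suffix) t<j i<j j<j' ij' enclosed
    ... | inj₂ refl = run-skips-no-complement-now x xs inv faithful (suffix-head suffix) i<j j<j' ij' enclosed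

open Greedy using (Invariant; run-skips-no-complement)

mainTheorem2 : (𝒜 : ComplementaryAlphabet) (n : ℕ) (P : Word 𝒜 n) →
    ∃[ S ] PValid 𝒜 n P S →
    ¬ ValidType2Move 𝒜 n P (T₀ 𝒜 n P)
mainTheorem2 𝒜 n P _ (_ , i , j , i' , j' , (i<j , j<i' , i'<j' , ij' , ji' , share , _ , _ , ij∈S' , _) , _ , compl) =
  run-skips-no-complement 𝒜 n P P initial [] (λ _ → refl) (≤-trans (s≤s z≤n) i<j) i<j (<-trans j<i' i'<j')
    (Any.reverse⁻ ij') enclosed (compl i j ij∈S')
  where
  initial : Invariant 𝒜 1 [] []
  initial = record { decreasing = [] ; stack-below = [] ; edges-below = [] }
  enclosed : Enclosed 𝒜 (greedyGo 𝒜 1 P [] []) i j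
  enclosed k l kl = shareVertex⇒enclosed 𝒜 (T₀ 𝒜 n P) i<j j<i' ji' share k l (Any.reverse⁺ kl)
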